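{- In the pre-positional semi-random graph process, $\tau_{\mathcal{C}_1}=1$.
   Context: Pre-positional semi-random graph process on $[n]$: $G_0$ is empty; in round $t$ the player chooses $v_t$ depending only on the history, then $u_t$ is chosen uniformly at random from $[n]$ and the edge $u_tv_t$ is added. $\mathcal{C}_1$ is the set of connected graphs on $[n]$. For an increasing property $\mathcal{P}$, strategy $\mathcal{S}$ and $0<q<1$, $\tau_{\mathcal{P}}(\mathcal{S},q,n)$ is the minimum $t\ge0$ with $\mathbb{P}[G_t\in\mathcal{P}]\ge q$ ($\infty$ if none), $\tau_{\mathcal{P}}(q,n)$ is its minimum over all strategies, and $\tau_{\mathcal{P}}=\lim_{q\uparrow1}\limsup_{n\to\infty}\tau_{\mathcal{P}}(q,n)/n$. -}

module Defs where

open import Data.Nat using (ℕ; zero; suc; _^_)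
open import Data.Fin using (Fin)
open import Data.Product using (Σ; _×_; _,_)
open import Data.Sum using (_⊎_)
open import Data.List using (List; []; _∷_; _++_; length)
open import Data.List.Membership.Propositional using (_∈_)
open import Data.List.Relation.Unary.All using (All)
open import Data.List.Relation.Unary.Unique.Propositional using (Unique)
open import Data.Vec using (Vec; []; _∷_)
open import Data.Integer using (+_)
open import Data.Rational using (ℚ; _/_; _*_; _≤_; _<_)
open import Relation.Binary.PropositionalEquality using (_≡_)

ℕ→ℚ : ℕ → ℚ
ℕ→ℚ k = (+ k) / 1

-- An edge u v (possibly a loop / repeated edge), stored as an ordered pair.
Edge : ℕ → Set
Edge n = Fin n × Fin n

-- History of the process = list of edges added so far, in chronological order.
-- A (deterministic) strategy picks v_t as a function of the history.
Strategy : ℕ → Set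
Strategy n = List (Edge n) → Fin n

run : ∀ {n t} → Strategy n → List (Edge n) → Vec (Fin n) t → List (Edge n)
run S hist [] = hist
run S hist (u ∷ us) = run S (hist ++ (u , S hist) ∷ []) us

edgesOf : ∀ {n t} → Strategy n → Vec (Fin n) t → List (Edge n)
edgesOf S us = run S [] us

data Reach {n : ℕ} (E : List (Edge n)) (x : Fin n) : Fin n → Set where
  here : Reach E x x
  step : ∀ {y z} → Reach E x y → ((y , z) ∈ E ⊎ (z , y) ∈ E) → Reach E x z

Connected : ∀ {n} → List (Edge n) → Set
Connected {n} E = (x y : Fin n) → Reach E x y

-- P[G_t ∈ C_1] ≥ q under strategy S, with u_1..u_t uniform on [n]^t:
-- at least q·n^t distinct outcome sequences yield a connected G_t.
ProbConnAtLeast : ∀ {n} → Strategy n → (t : ℕ) → ℚ → Set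
ProbConnAtLeast {n} S t q =
  Σ (List (Vec (Fin n) t)) λ L →
    Unique L × All (λ us → Connected (edgesOf S us)) L
    × q * ℕ→ℚ (n ^ t) ≤ ℕ→ℚ (length L)

-- P[G_t ∈ C_1] < q under strategy S: all connected outcomes lie in a
-- duplicate-free list of fewer than q·n^t sequences.
ProbConnBelow : ∀ {n} → Strategy n → (t : ℕ) → ℚ → Set
ProbConnBelow {n} S t q =
  Σ (List (Vec (Fin n) t)) λ L →
    Unique L × ((us : Vec (Fin n) t) → Connected (edgesOf S us) → us ∈ L)
    × ℕ→ℚ (length L) < q * ℕ→ℚ (n ^ t)

-- τ_{C_1}(q,n) ≤ b : some strategy and some t ≤ b reach P[G_t ∈ C_1] ≥ q.
TauAtMost : ℕ → ℚ → ℚ → Set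
TauAtMost n q b = Σ (Strategy n) λ S → Σ ℕ λ t → ℕ→ℚ t ≤ b × ProbConnAtLeast S t q

-- τ_{C_1}(q,n) ≥ b : for every strategy and every t < b, P[G_t ∈ C_1] < q.
TauAtLeast : ℕ → ℚ → ℚ → Set
TauAtLeast n q b = (S : Strategy n) (t : ℕ) → ℕ→ℚ t < b → ProbConnBelow S t q

-- Lower bound: in a union–find labelling of the components every edge merges at most two
-- classes, so a connected graph on n vertices needs n − 1 edges, i.e. n − 1 rounds.
-- Upper bound: the player always attaches v_t to a smallest component.  With k components
-- that component has at most n/k vertices, so u_t merges two components with probability at
-- least 1 − 1/k.  A potential charging K per component while fewer than K remain and 1 per
-- component otherwise bounds, Markov-style, the probability of still being disconnected after
-- r rounds; for K = 2ps and n ≥ K² it is at most 1/s after n + n/p rounds.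

module Submission where

open import Data.Nat using (ℕ; _≥_)
open import Data.Product using (Σ; _×_; _,_)

open import Defs

module Counting where

  open import Data.Bool using (Bool; true; false; _∧_; not)
  open import Data.Bool.Properties using (∧-identityʳ; ∧-zeroʳ)
  open import Data.Fin using (Fin; zero; suc)
  open import Data.Fin.Properties using (_≟_; suc-injective)
  open import Data.Nat using (ℕ; zero; suc; _+_; _*_; _≤_; z≤n)
  open import Data.Nat.Properties hiding (_≟_; suc-injective)
  open import Function using (_∘_)
  open import Relation.Binary.PropositionalEquality
  open import Relation.Nullary using (¬_; Dec; does; yes; no)
  open import Relation.Nullary.Decidable using (dec-true; dec-false)

  open import Algebra.Properties.Semiring.Sum +-*-semiring public
    using (sum; sum-cong-≗; ∑-distrib-+; ∑-comm; *-distribˡ-sum)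

  sum-const : ∀ n c → sum {n} (λ _ → c) ≡ n * c
  sum-const zero    c = refl
  sum-const (suc n) c = cong (c +_) (sum-const n c)

  sum-mono-≤ : ∀ {n} {f g : Fin n → ℕ} → (∀ i → f i ≤ g i) → sum f ≤ sum g
  sum-mono-≤ {zero}  f≤g = z≤n
  sum-mono-≤ {suc n} f≤g = +-mono-≤ (f≤g zero) (sum-mono-≤ (f≤g ∘ suc))

  sum-linear-≤ : ∀ {n} c k (x A : Fin n → ℕ) → (∀ i → c * x i ≤ A i + k * x i) → c * sum x ≤ sum A + k * sum x
  sum-linear-≤ c k x A pointwise = begin
    c * sum x                               ≡⟨ *-distribˡ-sum c x ⟩
    sum (λ i → c * x i)                     ≤⟨ sum-mono-≤ pointwise ⟩
    sum (λ i → A i + k * x i)               ≡⟨ ∑-distrib-+ A (λ i → k * x i) ⟩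
    sum A + sum (λ i → k * x i)             ≡⟨ cong (sum A +_) (*-distribˡ-sum k x) ⟨
    sum A + k * sum x                       ∎
    where open ≤-Reasoning

  dec-true⁻¹ : ∀ {A : Set} (a? : Dec A) → does a? ≡ true → A
  dec-true⁻¹ (yes a) _ = a

  dec-false⁻¹ : ∀ {A : Set} (a? : Dec A) → does a? ≡ false → ¬ A
  dec-false⁻¹ (no ¬a) _ = ¬a

  _==_ : ∀ {n} → Fin n → Fin n → Bool
  x == y = does (x ≟ y)

  ==-refl : ∀ {n} (x : Fin n) → (x == x) ≡ true
  ==-refl x = dec-true (x ≟ x) refl

  ==⇒≡ : ∀ {n} {x y : Fin n} → (x == y) ≡ true → x ≡ y
  ==⇒≡ {x = x} {y} = dec-true⁻¹ (x ≟ y)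

  ==-false⇒≢ : ∀ {n} {x y : Fin n} → (x == y) ≡ false → ¬ x ≡ y
  ==-false⇒≢ {x = x} {y} = dec-false⁻¹ (x ≟ y)

  ==-sym : ∀ {n} (x y : Fin n) → (x == y) ≡ (y == x)
  ==-sym x y with x ≟ y
  ... | yes refl = sym (==-refl x)
  ... | no x≢y   = sym (dec-false (y ≟ x) (x≢y ∘ sym))

  𝟙 : Bool → ℕ
  𝟙 true  = 1
  𝟙 false = 0

  count : ∀ {n} → (Fin n → Bool) → ℕ
  count P = sum (𝟙 ∘ P)

  count-cong : ∀ {n} {P Q : Fin n → Bool} → (∀ x → P x ≡ Q x) → count P ≡ count Q
  count-cong P≗Q = sum-cong-≗ (cong 𝟙 ∘ P≗Q)

  count-false : ∀ {n} (P : Fin n → Bool) → (∀ x → P x ≡ false) → count P ≡ 0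
  count-false {n} P never = trans (count-cong never) (trans (sum-const n 0) (*-zeroʳ n))

  count-true : ∀ n → count {n} (λ _ → true) ≡ n
  count-true n = trans (sum-const n 1) (*-identityʳ n)

  count-== : ∀ {n} (w : Fin n) → count (_== w) ≡ 1
  count-== {suc n} zero    = cong suc (count-false {n} (λ x → suc x == zero) (λ _ → refl))
  count-== {suc n} (suc w) = count-== w

  count-remove : ∀ {n} (P : Fin n → Bool) (w : Fin n) →
    count P ≡ count (λ x → P x ∧ not (x == w)) + 𝟙 (P w)
  count-remove {suc n} P zero = begin
      𝟙 (P zero) + count (P ∘ suc)               ≡⟨ +-comm (𝟙 (P zero)) _ ⟩
      count (P ∘ suc) + 𝟙 (P zero)
        ≡⟨ cong (_+ 𝟙 (P zero)) (count-cong {P = P ∘ suc} (sym ∘ ∧-identityʳ ∘ P ∘ suc)) ⟩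
      count (λ x → P (suc x) ∧ true) + 𝟙 (P zero)
        ≡⟨ cong (λ b → 𝟙 b + count (λ x → P (suc x) ∧ true) + 𝟙 (P zero)) (sym (∧-zeroʳ (P zero))) ⟩
      count (λ x → P x ∧ not (x == zero)) + 𝟙 (P zero) ∎
    where open ≡-Reasoning
  count-remove {suc n} P (suc w) = begin
      𝟙 (P zero) + count (P ∘ suc)
        ≡⟨ cong (𝟙 (P zero) +_) (count-remove (P ∘ suc) w) ⟩
      𝟙 (P zero) + (count (λ x → P (suc x) ∧ not (x == w)) + 𝟙 (P (suc w)))
        ≡⟨ sym (+-assoc (𝟙 (P zero)) _ _) ⟩
      𝟙 (P zero) + count (λ x → P (suc x) ∧ not (x == w)) + 𝟙 (P (suc w))
        ≡⟨ cong (λ b → 𝟙 b + count (λ x → P (suc x) ∧ not (x == w)) + 𝟙 (P (suc w))) (sym (∧-identityʳ (P zero))) ⟩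
      count (λ x → P x ∧ not (x == suc w)) + 𝟙 (P (suc w)) ∎
    where open ≡-Reasoning

  count-≤1 : ∀ {n} (P : Fin n → Bool) → (∀ {x y} → P x ≡ true → P y ≡ true → x ≡ y) → count P ≤ 1
  count-≤1 {zero}  P at-most-once = z≤n
  count-≤1 {suc n} P at-most-once with P zero in P0
  ... | false = count-≤1 (P ∘ suc) (λ Px Py → suc-injective (at-most-once Px Py))
  ... | true  = ≤-reflexive (cong suc (count-false (P ∘ suc) only-zero))
    where
    only-zero : ∀ x → P (suc x) ≡ false
    only-zero x with P (suc x) in Px
    ... | false = refl
    ... | true  with () ← at-most-once P0 Px

  count-≥1 : ∀ {n} (P : Fin n → Bool) (w : Fin n) → P w ≡ true → 1 ≤ count P
  count-≥1 P w Pw rewrite count-remove P w | Pw = m≤n+m 1 _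

  count-≥2 : ∀ {n} (P : Fin n → Bool) {a b : Fin n} → P a ≡ true → P b ≡ true → ¬ a ≡ b → 2 ≤ count P
  count-≥2 P {a} {b} Pa Pb a≢b rewrite count-remove P a | Pa = +-monoˡ-≤ 1 (count-≥1 _ b Pb∧b≢a)
    where
    Pb∧b≢a : P b ∧ not (b == a) ≡ true
    Pb∧b≢a rewrite Pb | dec-false (b ≟ a) (a≢b ∘ sym) = refl

module FinConcat where

  open import Data.Empty using (⊥)
  open import Data.Fin using (Fin; zero; suc)
  open import Data.Fin.Properties using (suc-injective)
  open import Data.List using (List; []; _++_; length)
  open import Data.List.Properties using (length-++)
  open import Data.List.Membership.Propositional using (_∈_)
  open import Data.List.Membership.Propositional.Properties using (∈-++⁻)
  open import Data.List.Relation.Unary.All using (All; [])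
  import Data.List.Relation.Unary.All.Properties as All
  open import Data.List.Relation.Unary.AllPairs using ([])
  open import Data.List.Relation.Unary.Unique.Propositional using (Unique)
  import Data.List.Relation.Unary.Unique.Propositional.Properties as Unique
  open import Data.Nat using (zero; suc; _+_)
  open import Data.Product using (Σ; _,_)
  open import Data.Sum using (inj₁; inj₂)
  open import Data.Vec.Functional using (foldr)
  open import Function using (_∘_)
  open import Relation.Binary.PropositionalEquality

  open Counting using (sum)

  concatFin : ∀ {A : Set} {k} → (Fin k → List A) → List A
  concatFin = foldr _++_ []

  length-concatFin : ∀ {A : Set} {k} (g : Fin k → List A) → length (concatFin g) ≡ sum (length ∘ g)
  length-concatFin {k = zero}  g = refl
  length-concatFin {k = suc k} g = trans (length-++ (g zero)) (cong (length (g zero) +_) (length-concatFin (g ∘ suc)))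

  All-concatFin : ∀ {A : Set} {P : A → Set} {k} (g : Fin k → List A) → (∀ i → All P (g i)) → All P (concatFin g)
  All-concatFin {k = zero}  g all = []
  All-concatFin {k = suc k} g all = All.++⁺ (all zero) (All-concatFin (g ∘ suc) (all ∘ suc))

  ∈-concatFin⁻ : ∀ {A : Set} {k} (g : Fin k → List A) {x} → x ∈ concatFin g → Σ (Fin k) λ i → x ∈ g i
  ∈-concatFin⁻ {k = suc k} g x∈ with ∈-++⁻ (g zero) x∈
  ... | inj₁ x∈g₀ = zero , x∈g₀
  ... | inj₂ x∈gs with ∈-concatFin⁻ (g ∘ suc) x∈gs
  ...   | i , x∈gᵢ = suc i , x∈gᵢ

  Unique-concatFin : ∀ {A : Set} {k} (g : Fin k → List A) → (∀ i → Unique (g i)) →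
    (∀ i j {x} → x ∈ g i → x ∈ g j → i ≡ j) → Unique (concatFin g)
  Unique-concatFin {k = zero}  g unique disjoint = []
  Unique-concatFin {k = suc k} g unique disjoint = Unique.++⁺ (unique zero)
    (Unique-concatFin (g ∘ suc) (unique ∘ suc) (λ i j x∈gᵢ x∈gⱼ → suc-injective (disjoint (suc i) (suc j) x∈gᵢ x∈gⱼ)))
    (λ (x∈g₀ , x∈gs) → zero≢suc (∈-concatFin⁻ (g ∘ suc) x∈gs) x∈g₀)
    where
    zero≢suc : ∀ {x} → (Σ (Fin k) λ i → x ∈ g (suc i)) → x ∈ g zero → ⊥
    zero≢suc (i , x∈gᵢ) x∈g₀ with () ← disjoint zero (suc i) x∈g₀ x∈gᵢ

module Components (n : ℕ) where

  open import Data.Bool using (Bool; true; false; if_then_else_; _∧_; not)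
  open import Data.Empty using (⊥-elim)
  open import Data.Fin using (Fin)
  open import Data.List using (List; []; _∷_; _++_; length; foldl)
  open import Data.List.Properties using (foldl-++; length-++; ++-assoc; ++-identityʳ)
  open import Data.List.Membership.Propositional using (_∈_)
  open import Data.List.Membership.Propositional.Properties using (∈-++⁺ˡ; ∈-++⁺ʳ; ∈-++⁻)
  open import Data.List.Relation.Unary.Any using (here)
  open import Data.Nat using (_+_; _*_; _≤_)
  open import Data.Nat.Properties hiding (_≟_)
  open import Data.Product using (_×_; _,_; proj₂)
  open import Data.Sum using (inj₁; inj₂)
  open import Function using (id; _∘_)
  open import Relation.Binary.PropositionalEquality

  open Counting

  Reach-trans : ∀ {E : List (Edge n)} {x y z} → Reach E x y → Reach E y z → Reach E x z
  Reach-trans p here       = p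
  Reach-trans p (step q e) = step (Reach-trans p q) e

  Reach-sym : ∀ {E : List (Edge n)} {x y} → Reach E x y → Reach E y x
  Reach-sym here                = here
  Reach-sym (step p (inj₁ e)) = Reach-trans (step here (inj₂ e)) (Reach-sym p)
  Reach-sym (step p (inj₂ e)) = Reach-trans (step here (inj₁ e)) (Reach-sym p)

  Reach-++ : ∀ {E : List (Edge n)} E′ {x y} → Reach E x y → Reach (E ++ E′) x y
  Reach-++ E′ here              = here
  Reach-++ E′ (step p (inj₁ e)) = step (Reach-++ E′ p) (inj₁ (∈-++⁺ˡ e))
  Reach-++ E′ (step p (inj₂ e)) = step (Reach-++ E′ p) (inj₂ (∈-++⁺ˡ e))

  -- A labelling maps every vertex to the representative of its class; label E is the
  -- union–find labelling of the components of E, built edge by edge.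
  Labelling : Set
  Labelling = Fin n → Fin n

  merge : Labelling → Edge n → Labelling
  merge f (u , v) y = if f y == f v then f u else f y

  label : List (Edge n) → Labelling
  label = foldl merge id

  label-snoc : ∀ E e y → label (E ++ e ∷ []) y ≡ merge (label E) e y
  label-snoc E e y = cong (λ f → f y) (foldl-++ merge id E (e ∷ []))

  label-induction : (I : List (Edge n) → Labelling → Set) → I [] id →
    (∀ E f e → I E f → I (E ++ e ∷ []) (merge f e)) → ∀ E → I E (label E)
  label-induction I base preserved E = go E [] id base
    where
    go : ∀ E₂ E f → I E f → I (E ++ E₂) (foldl merge f E₂)
    go []       E f inv = subst (λ X → I X f) (sym (++-identityʳ E)) inv
    go (e ∷ E₂) E f inv =
      subst (λ X → I X _) (++-assoc E (e ∷ []) E₂) (go E₂ (E ++ e ∷ []) (merge f e) (preserved E f e inv))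

  Idempotent : Labelling → Set
  Idempotent f = ∀ x → f (f x) ≡ f x

  merge-idempotent : ∀ f e → Idempotent f → Idempotent (merge f e)
  merge-idempotent f (u , v) idem y with f y == f v in fy=fv
  ... | true rewrite idem u with f u == f v
  ...   | true  = refl
  ...   | false = refl
  merge-idempotent f (u , v) idem y | false rewrite idem y | fy=fv = refl

  label-idempotent : ∀ E → Idempotent (label E)
  label-idempotent = label-induction (λ _ → Idempotent) (λ _ → refl) (λ _ f e → merge-idempotent f e)

  label-sound : ∀ E x → Reach E x (label E x)
  label-sound = label-induction (λ E f → ∀ x → Reach E x (f x)) (λ _ → here) sound-step
    where
    sound-step : ∀ E f e → (∀ x → Reach E x (f x)) → ∀ x → Reach (E ++ e ∷ []) x (merge f e x)
    sound-step E f (u , v) sound y with f y == f v in fy=fv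
    ... | false = Reach-++ _ (sound y)
    ... | true  = Reach-trans (Reach-++ _ (sound y))
                    (subst (λ z → Reach _ z (f u)) (sym (==⇒≡ {x = f y} fy=fv))
                      (Reach-trans (Reach-++ _ (Reach-sym (sound v)))
                        (Reach-trans (step here (inj₂ (∈-++⁺ʳ E (here refl)))) (Reach-++ _ (sound u)))))

  label-respects-edges : ∀ E {a b} → (a , b) ∈ E → label E a ≡ label E b
  label-respects-edges = label-induction (λ E f → ∀ {a b} → (a , b) ∈ E → f a ≡ f b) (λ ()) respects-step
    where
    respects-step : ∀ E f e → (∀ {a b} → (a , b) ∈ E → f a ≡ f b) →
      ∀ {a b} → (a , b) ∈ E ++ e ∷ [] → merge f e a ≡ merge f e b
    respects-step E f e respects ab∈ with ∈-++⁻ E ab∈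
    respects-step E f (u , v) respects ab∈ | inj₁ ab∈E rewrite respects ab∈E = refl
    respects-step E f (u , v) respects ab∈ | inj₂ (here refl) rewrite ==-refl (f v) with f u == f v
    ... | true  = refl
    ... | false = refl

  Reach⇒label-≡ : ∀ E {x y} → Reach E x y → label E x ≡ label E y
  Reach⇒label-≡ E here              = refl
  Reach⇒label-≡ E (step p (inj₁ e)) = trans (Reach⇒label-≡ E p) (label-respects-edges E e)
  Reach⇒label-≡ E (step p (inj₂ e)) = trans (Reach⇒label-≡ E p) (sym (label-respects-edges E e))

  isRoot : Labelling → Fin n → Bool
  isRoot f x = f x == x

  #roots : Labelling → ℕ
  #roots f = count (isRoot f)

  #roots-cong : ∀ {f g} → (∀ x → f x ≡ g x) → #roots f ≡ #roots g
  #roots-cong f≗g = count-cong (λ x → cong (_== x) (f≗g x))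

  #roots-id : #roots id ≡ n
  #roots-id = trans (count-cong {P = isRoot id} {Q = λ _ → true} ==-refl) (count-true n)

  isRoot-image : ∀ f → Idempotent f → ∀ x → isRoot f (f x) ≡ true
  isRoot-image f idem x = trans (cong (_== f x) (idem x)) (==-refl (f x))

  merge-trivial : ∀ f u v → (f u == f v) ≡ true → ∀ y → merge f (u , v) y ≡ f y
  merge-trivial f u v fu=fv y with f y == f v in fy=fv
  ... | true  = trans (==⇒≡ {x = f u} fu=fv) (sym (==⇒≡ {x = f y} fy=fv))
  ... | false = refl

  isRoot-merge : ∀ f u v → Idempotent f → (f u == f v) ≡ false →
    ∀ x → isRoot (merge f (u , v)) x ≡ (isRoot f x ∧ not (x == f v))
  isRoot-merge f u v idem fu≠fv x with f x == f v in fx=fv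
  ... | true with f u == x in fu=x
  ...   | true  = ⊥-elim (==-false⇒≢ fu≠fv
                    (trans (sym (idem u)) (trans (cong f (==⇒≡ {x = f u} fu=x)) (==⇒≡ {x = f x} fx=fv))))
  ...   | false with f x == x in fx=x
  ...     | false = refl
  ...     | true  = sym (cong not (trans (cong (_== f v) (sym (==⇒≡ {x = f x} fx=x))) fx=fv))
  isRoot-merge f u v idem fu≠fv x | false with f x == x in fx=x
  ... | false = refl
  ... | true  = sym (cong not (trans (cong (_== f v) (sym (==⇒≡ {x = f x} fx=x))) fx=fv))

  #roots-merge : ∀ f u v → Idempotent f → (f u == f v) ≡ false → #roots (merge f (u , v)) + 1 ≡ #roots f
  #roots-merge f u v idem fu≠fv = sym (begin
      #roots f                                               ≡⟨ count-remove (isRoot f) (f v) ⟩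
      count (λ x → isRoot f x ∧ not (x == f v)) + 𝟙 (isRoot f (f v))
        ≡⟨ cong₂ _+_ (sym (count-cong (isRoot-merge f u v idem fu≠fv))) (cong 𝟙 (isRoot-image f idem v)) ⟩
      #roots (merge f (u , v)) + 1                           ∎)
    where open ≡-Reasoning

  #roots-merge-≥ : ∀ f e → Idempotent f → #roots f ≤ #roots (merge f e) + 1
  #roots-merge-≥ f (u , v) idem with f u == f v in fu=fv
  ... | true  = ≤-trans (m≤m+n (#roots f) 1)
                  (≤-reflexive (cong (_+ 1) (sym (#roots-cong (merge-trivial f u v fu=fv)))))
  ... | false = ≤-reflexive (sym (#roots-merge f u v idem fu=fv))

  n≤#roots+length : ∀ E → n ≤ #roots (label E) + length E
  n≤#roots+length E = proj₂ (label-induction Invariant ((λ _ → refl) , ≤-reflexive base) preserved E)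
    where
    Invariant : List (Edge n) → Labelling → Set
    Invariant E f = Idempotent f × n ≤ #roots f + length E
    base : n ≡ #roots id + 0
    base = sym (trans (+-identityʳ _) #roots-id)
    preserved : ∀ E f e → Invariant E f → Invariant (E ++ e ∷ []) (merge f e)
    preserved E f e (idem , bound) = merge-idempotent f e idem , (begin
      n                                        ≤⟨ bound ⟩
      #roots f + length E                      ≤⟨ +-monoˡ-≤ (length E) (#roots-merge-≥ f e idem) ⟩
      #roots (merge f e) + 1 + length E        ≡⟨ +-assoc _ 1 (length E) ⟩
      #roots (merge f e) + (1 + length E)      ≡⟨ cong (#roots (merge f e) +_) (+-comm 1 (length E)) ⟩
      #roots (merge f e) + (length E + 1)      ≡⟨ cong (#roots (merge f e) +_) (sym (length-++ E)) ⟩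
      #roots (merge f e) + length (E ++ e ∷ []) ∎)
      where open ≤-Reasoning

  constant⇒#roots≤1 : ∀ f → (∀ x y → f x ≡ f y) → #roots f ≤ 1
  constant⇒#roots≤1 f constant = count-≤1 (isRoot f) (λ {x} {y} fx=x fy=y →
    trans (sym (==⇒≡ {x = f x} fx=x)) (trans (constant x y) (==⇒≡ {x = f y} fy=y)))

  #roots≤1⇒constant : ∀ f → Idempotent f → #roots f ≤ 1 → ∀ x y → f x ≡ f y
  #roots≤1⇒constant f idem ≤1 x y with f x == f y in fx=fy
  ... | true  = ==⇒≡ {x = f x} fx=fy
  ... | false = ⊥-elim (<⇒≱ 2≤#roots ≤1)
    where
    2≤#roots : 2 ≤ #roots f
    2≤#roots = count-≥2 (isRoot f) (isRoot-image f idem x) (isRoot-image f idem y) (==-false⇒≢ fx=fy)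

  #roots≤1⇒Connected : ∀ E → #roots (label E) ≤ 1 → Connected E
  #roots≤1⇒Connected E ≤1 x y =
    Reach-trans (label-sound E x) (subst (λ z → Reach E z y) (sym same) (Reach-sym (label-sound E y)))
    where
    same : label E x ≡ label E y
    same = #roots≤1⇒constant (label E) (label-idempotent E) ≤1 x y

  Connected⇒#roots≤1 : ∀ E → Connected E → #roots (label E) ≤ 1
  Connected⇒#roots≤1 E connected = constant⇒#roots≤1 (label E) (λ x y → Reach⇒label-≡ E (connected x y))

  classSize : Labelling → Fin n → ℕ
  classSize f c = count (λ y → f y == c)

  sum-classSizes : ∀ f → Idempotent f → sum (λ c → 𝟙 (isRoot f c) * classSize f c) ≡ n
  sum-classSizes f idem = begin
      sum (λ c → 𝟙 (isRoot f c) * classSize f c)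
        ≡⟨ sum-cong-≗ (λ c → *-distribˡ-sum (𝟙 (isRoot f c)) (λ y → 𝟙 (f y == c))) ⟩
      sum (λ c → sum (λ y → 𝟙 (isRoot f c) * 𝟙 (f y == c)))
        ≡⟨ ∑-comm (λ c y → 𝟙 (isRoot f c) * 𝟙 (f y == c)) ⟩
      sum (λ y → sum (λ c → 𝟙 (isRoot f c) * 𝟙 (f y == c)))
        ≡⟨ sum-cong-≗ (λ y → sum-cong-≗ (only-root-of y)) ⟩
      sum (λ y → count (_== f y))
        ≡⟨ sum-cong-≗ (count-== ∘ f) ⟩
      sum {n} (λ _ → 1)
        ≡⟨ count-true n ⟩
      n ∎
    where
    open ≡-Reasoning
    only-root-of : ∀ y c → 𝟙 (isRoot f c) * 𝟙 (f y == c) ≡ 𝟙 (c == f y)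
    only-root-of y c with f y == c in fy=c
    ... | false rewrite ==-sym c (f y) | fy=c = *-zeroʳ (𝟙 (isRoot f c))
    ... | true rewrite sym (==⇒≡ {x = f y} fy=c) | isRoot-image f idem y | ==-refl (f y) = refl

  -- Summing the size of the smallest class over all roots undercounts the n vertices.
  #roots*minClassSize≤n : ∀ f v → Idempotent f → (∀ x → classSize f (f v) ≤ classSize f (f x)) →
    #roots f * classSize f (f v) ≤ n
  #roots*minClassSize≤n f v idem minimal = begin
      #roots f * a                               ≡⟨ *-comm (#roots f) a ⟩
      a * #roots f                               ≡⟨ *-distribˡ-sum a (𝟙 ∘ isRoot f) ⟩
      sum (λ c → a * 𝟙 (isRoot f c))             ≤⟨ sum-mono-≤ a≤classSize ⟩
      sum (λ c → 𝟙 (isRoot f c) * classSize f c) ≡⟨ sum-classSizes f idem ⟩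
      n                                          ∎
    where
    open ≤-Reasoning
    a = classSize f (f v)
    a≤classSize : ∀ c → a * 𝟙 (isRoot f c) ≤ 𝟙 (isRoot f c) * classSize f c
    a≤classSize c with isRoot f c in fc=c
    ... | false = ≤-reflexive (*-zeroʳ a)
    ... | true  = begin
      a * 1            ≡⟨ *-identityʳ a ⟩
      a                ≤⟨ minimal c ⟩
      classSize f (f c) ≡⟨ cong (classSize f) (==⇒≡ {x = f c} fc=c) ⟩
      classSize f c    ≡⟨ sym (+-identityʳ _) ⟩
      1 * classSize f c ∎

  module _ (E : List (Edge n)) (u v : Fin n) where

    #roots-snoc-same : (label E u == label E v) ≡ true → #roots (label (E ++ (u , v) ∷ [])) ≡ #roots (label E)
    #roots-snoc-same same =
      #roots-cong (λ y → trans (label-snoc E (u , v) y) (merge-trivial (label E) u v same y))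

    #roots-snoc-merge : (label E u == label E v) ≡ false → #roots (label (E ++ (u , v) ∷ [])) + 1 ≡ #roots (label E)
    #roots-snoc-merge different =
      trans (cong (_+ 1) (#roots-cong (label-snoc E (u , v))))
        (#roots-merge (label E) u v (label-idempotent E) different)

    #roots-snoc-≤ : #roots (label (E ++ (u , v) ∷ [])) ≤ #roots (label E)
    #roots-snoc-≤ with label E u == label E v in same
    ... | true  = ≤-reflexive (#roots-snoc-same same)
    ... | false = ≤-trans (m≤m+n _ 1) (≤-reflexive (#roots-snoc-merge same))

module Outcomes (n : ℕ) (S : Strategy n) where

  open import Data.Bool using (Bool; true; false; if_then_else_)
  open import Data.Fin using (Fin)
  open import Data.List using (List; []; _∷_; _++_; length; map)
  open import Data.List.Properties using (length-map; length-++)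
  open import Data.List.Membership.Propositional using (_∈_)
  open import Data.List.Membership.Propositional.Properties using (∈-map⁻)
  open import Data.List.Relation.Unary.All using (All; []; _∷_)
  import Data.List.Relation.Unary.All.Properties as All
  open import Data.List.Relation.Unary.AllPairs using ([]; _∷_)
  open import Data.List.Relation.Unary.Unique.Propositional using (Unique)
  import Data.List.Relation.Unary.Unique.Propositional.Properties as Unique
  open import Data.Nat using (suc; zero; _+_; _*_; _^_; _≤_; _≤?_)
  open import Data.Nat.Properties hiding (_≟_)
  open import Data.Product using (_,_)
  open import Data.Vec using (Vec; []; _∷_)
  open import Data.Vec.Properties using (∷-injectiveˡ; ∷-injectiveʳ)
  open import Function using (_∘_)
  open import Relation.Binary.PropositionalEquality
  open import Relation.Nullary using (does)
  open import Relation.Nullary.Decidable using (dec-true)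

  open Counting
  open FinConcat
  open Components n

  isConnected : List (Edge n) → Bool
  isConnected E = does (#roots (label E) ≤? 1)

  isConnected⇒#roots≤1 : ∀ E → isConnected E ≡ true → #roots (label E) ≤ 1
  isConnected⇒#roots≤1 E = dec-true⁻¹ (#roots (label E) ≤? 1)

  isConnected≡false⇒2≤#roots : ∀ E → isConnected E ≡ false → 2 ≤ #roots (label E)
  isConnected≡false⇒2≤#roots E disconn = ≰⇒> (dec-false⁻¹ (#roots (label E) ≤? 1) disconn)

  isConnected⇒Connected : ∀ E → isConnected E ≡ true → Connected E
  isConnected⇒Connected E conn = #roots≤1⇒Connected E (isConnected⇒#roots≤1 E conn)

  next : List (Edge n) → Fin n → List (Edge n)
  next E u = E ++ (u , S E) ∷ []

  connectedRuns : List (Edge n) → (r : ℕ) → List (Vec (Fin n) r)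
  connectedRuns E zero    = if isConnected E then [] ∷ [] else []
  connectedRuns E (suc r) = concatFin (λ u → map (u ∷_) (connectedRuns (next E u) r))

  #disconnectedRuns : List (Edge n) → ℕ → ℕ
  #disconnectedRuns E zero    = if isConnected E then 0 else 1
  #disconnectedRuns E (suc r) = sum (λ u → #disconnectedRuns (next E u) r)

  connectedRuns-connected : ∀ E r → All (λ us → Connected (run S E us)) (connectedRuns E r)
  connectedRuns-connected E zero with isConnected E in conn
  ... | true  = isConnected⇒Connected E conn ∷ []
  ... | false = []
  connectedRuns-connected E (suc r) =
    All-concatFin _ (λ u → All.map⁺ (connectedRuns-connected (next E u) r))

  connectedRuns-unique : ∀ E r → Unique (connectedRuns E r)
  connectedRuns-unique E zero with isConnected E
  ... | true  = [] ∷ []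
  ... | false = []
  connectedRuns-unique E (suc r) =
    Unique-concatFin _ (λ u → Unique.map⁺ ∷-injectiveʳ (connectedRuns-unique (next E u) r)) heads-differ
    where
    heads-differ : ∀ i j {us} → us ∈ map (i ∷_) (connectedRuns (next E i) r) →
      us ∈ map (j ∷_) (connectedRuns (next E j) r) → i ≡ j
    heads-differ i j us∈ᵢ us∈ⱼ with ∈-map⁻ (i ∷_) us∈ᵢ | ∈-map⁻ (j ∷_) us∈ⱼ
    ... | _ , _ , refl | _ , _ , i∷vs≡j∷ws = ∷-injectiveˡ i∷vs≡j∷ws

  length-connectedRuns+#disconnectedRuns : ∀ E r → length (connectedRuns E r) + #disconnectedRuns E r ≡ n ^ r
  length-connectedRuns+#disconnectedRuns E zero with isConnected E
  ... | true  = refl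
  ... | false = refl
  length-connectedRuns+#disconnectedRuns E (suc r) = begin
      length (concatFin runs) + sum (λ u → #disconnectedRuns (next E u) r)
        ≡⟨ cong (_+ sum (λ u → #disconnectedRuns (next E u) r)) (length-concatFin runs) ⟩
      sum (length ∘ runs) + sum (λ u → #disconnectedRuns (next E u) r)
        ≡⟨ ∑-distrib-+ (length ∘ runs) (λ u → #disconnectedRuns (next E u) r) ⟨
      sum (λ u → length (runs u) + #disconnectedRuns (next E u) r)
        ≡⟨ sum-cong-≗ (λ u → cong (_+ #disconnectedRuns (next E u) r)
                                   (length-map (u ∷_) (connectedRuns (next E u) r))) ⟩
      sum (λ u → length (connectedRuns (next E u) r) + #disconnectedRuns (next E u) r)
        ≡⟨ sum-cong-≗ (λ u → length-connectedRuns+#disconnectedRuns (next E u) r) ⟩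
      sum {n} (λ _ → n ^ r)
        ≡⟨ sum-const n (n ^ r) ⟩
      n * n ^ r ∎
    where
    open ≡-Reasoning
    runs : Fin n → List (Vec (Fin n) (suc r))
    runs u = map (u ∷_) (connectedRuns (next E u) r)

  #disconnectedRuns≤ : ∀ E r → #disconnectedRuns E r ≤ n ^ r
  #disconnectedRuns≤ E r = subst (#disconnectedRuns E r ≤_) (length-connectedRuns+#disconnectedRuns E r) (m≤n+m _ _)

  isConnected-next : ∀ E u → isConnected E ≡ true → isConnected (next E u) ≡ true
  isConnected-next E u conn = dec-true (_ ≤? 1) (≤-trans (#roots-snoc-≤ E u (S E)) (isConnected⇒#roots≤1 E conn))

  isConnected⇒#disconnectedRuns≡0 : ∀ E r → isConnected E ≡ true → #disconnectedRuns E r ≡ 0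
  isConnected⇒#disconnectedRuns≡0 E zero    conn rewrite conn = refl
  isConnected⇒#disconnectedRuns≡0 E (suc r) conn = begin
    sum (λ u → #disconnectedRuns (next E u) r)
      ≡⟨ sum-cong-≗ (λ u → isConnected⇒#disconnectedRuns≡0 (next E u) r (isConnected-next E u conn)) ⟩
    sum {n} (λ _ → 0) ≡⟨ sum-const n 0 ⟩
    n * 0             ≡⟨ *-zeroʳ n ⟩
    0                 ∎
    where open ≡-Reasoning

  length-run : ∀ E {t} (us : Vec (Fin n) t) → length (run S E us) ≡ length E + t
  length-run E []       = sym (+-identityʳ (length E))
  length-run E {suc t} (u ∷ us) = begin
    length (run S (next E u) us) ≡⟨ length-run (next E u) us ⟩
    length (next E u) + t        ≡⟨ cong (_+ t) (length-++ E) ⟩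
    length E + 1 + t             ≡⟨ +-assoc (length E) 1 t ⟩
    length E + suc t             ∎
    where open ≡-Reasoning

  Connected⇒n≤1+t : ∀ {t} (us : Vec (Fin n) t) → Connected (edgesOf S us) → n ≤ suc t
  Connected⇒n≤1+t {t} us connected = begin
    n                                  ≤⟨ n≤#roots+length E ⟩
    #roots (label E) + length E        ≤⟨ +-monoˡ-≤ (length E) (Connected⇒#roots≤1 E connected) ⟩
    suc (length E)                     ≡⟨ cong suc (length-run [] us) ⟩
    suc t                              ∎
    where
    open ≤-Reasoning
    E = edgesOf S us

module JoinSmallest (m : ℕ) where

  open import Data.Bool using (true; false; if_then_else_)
  open import Data.Fin using (Fin; zero)
  open import Data.List using (List; []; allFin)
  open import Data.List.Extrema.Nat using (argmin; f[argmin]≤f[xs])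
  open import Data.List.Membership.Propositional.Properties using (∈-allFin)
  import Data.List.Relation.Unary.All as All
  open import Data.Nat using (suc; zero; _+_; _*_; _^_; _≤_; _<_; _≤?_; _<?_; z≤n; s≤s; NonZero)
  open import Data.Nat.Properties hiding (_≟_)
  open import Data.Nat.Tactic.RingSolver using (solve-∀)
  open import Relation.Binary.PropositionalEquality
  open import Relation.Nullary using (does; yes; no)
  open import Relation.Nullary.Decidable using (dec-true; dec-false)

  open Counting

  n : ℕ
  n = suc m

  open Components n

  joinSmallest : Strategy n
  joinSmallest E = argmin (λ x → classSize (label E) (label E x)) zero (allFin n)

  joinSmallest-minimal : ∀ E x →
    classSize (label E) (label E (joinSmallest E)) ≤ classSize (label E) (label E x)
  joinSmallest-minimal E x =
    All.lookup (f[argmin]≤f[xs] {f = λ x → classSize (label E) (label E x)} zero (allFin n)) (∈-allFin x)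

  open Outcomes n joinSmallest public

  module Potential (K : ℕ) where

    weight : ℕ → ℕ
    weight k = if does (k <? K) then K else 1

    weight-< : ∀ {k} → k < K → weight k ≡ K
    weight-< {k} k<K rewrite dec-true (k <? K) k<K = refl

    weight-≥ : ∀ {k} → K ≤ k → weight k ≡ 1
    weight-≥ {k} K≤k rewrite dec-false (k <? K) (≤⇒≯ K≤k) = refl

    potential : ℕ → ℕ
    potential zero          = 0
    potential (suc zero)    = 0
    potential (suc (suc j)) = potential (suc j) + weight (suc j)

    -- With 2 + j classes the smallest one has size a ≤ n / (2 + j), so the weight
    -- pays for the rounds in which u falls into it.
    weight-absorbs : ∀ j a → (2 + j) * a ≤ n → (weight (suc j) + K) * a ≤ n * weight (suc j)
    weight-absorbs j a ka≤n with suc j <? K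
    ... | yes 1+j<K rewrite weight-< 1+j<K = begin
      (K + K) * a         ≡⟨ cong (λ c → (K + c) * a) (+-identityʳ K) ⟨
      (2 * K) * a         ≡⟨ cong (_* a) (*-comm 2 K) ⟩
      K * 2 * a           ≡⟨ *-assoc K 2 a ⟩
      K * (2 * a)         ≤⟨ *-monoʳ-≤ K (*-monoˡ-≤ a (m≤m+n 2 j)) ⟩
      K * ((2 + j) * a)   ≤⟨ *-monoʳ-≤ K ka≤n ⟩
      K * n               ≡⟨ *-comm K n ⟩
      n * K               ∎
      where open ≤-Reasoning
    ... | no 1+j≮K rewrite weight-≥ (≮⇒≥ 1+j≮K) = begin
      (1 + K) * a         ≤⟨ *-monoˡ-≤ a (s≤s (≮⇒≥ 1+j≮K)) ⟩
      (2 + j) * a         ≤⟨ ka≤n ⟩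
      n                   ≡⟨ *-identityʳ n ⟨
      n * 1               ∎
      where open ≤-Reasoning

    potential-≤-K* : ∀ j → j ≤ K → potential j ≤ K * j
    potential-≤-K* zero          _     = z≤n
    potential-≤-K* (suc zero)    _     = z≤n
    potential-≤-K* (suc (suc j)) 2+j≤K = begin
      potential (suc j) + weight (suc j) ≡⟨ cong (potential (suc j) +_) (weight-< 2+j≤K) ⟩
      potential (suc j) + K              ≤⟨ +-monoˡ-≤ K (potential-≤-K* (suc j) (<⇒≤ 2+j≤K)) ⟩
      K * suc j + K                      ≡⟨ +-comm (K * suc j) K ⟩
      K + K * suc j                      ≡⟨ *-suc K (suc j) ⟨
      K * suc (suc j)                    ∎
      where open ≤-Reasoning

    potential-≤ : ∀ j → potential j ≤ K * K + j
    potential-≤ j with j ≤? K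
    ... | yes j≤K = ≤-trans (potential-≤-K* j j≤K) (≤-trans (*-monoʳ-≤ K j≤K) (m≤m+n (K * K) j))
    potential-≤ zero          | no _    = z≤n
    potential-≤ (suc zero)    | no _    = z≤n
    potential-≤ (suc (suc i)) | no 2+i≰K = begin
      potential (suc i) + weight (suc i) ≡⟨ cong (potential (suc i) +_) (weight-≥ (≤-pred (≰⇒> 2+i≰K))) ⟩
      potential (suc i) + 1              ≤⟨ +-monoˡ-≤ 1 (potential-≤ (suc i)) ⟩
      K * K + suc i + 1                  ≡⟨ +-assoc (K * K) (suc i) 1 ⟩
      K * K + (suc i + 1)                ≡⟨ cong (K * K +_) (+-comm (suc i) 1) ⟩
      K * K + suc (suc i)                ∎
      where open ≤-Reasoning

    -- The subtraction-free form of  (2 + r − k) · K · #disconnected ≤ n^r · potential k :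
    -- from k classes, the probability of still being disconnected after r more rounds
    -- is at most potential k / (K · (2 + r − k)).
    PotentialBound : ℕ → List (Edge n) → ℕ → Set
    PotentialBound r E k =
      (2 + r) * (K * #disconnectedRuns E r) ≤ n ^ r * potential k + k * (K * #disconnectedRuns E r)

    PotentialBound-0 : ∀ r E k → #disconnectedRuns E r ≡ 0 → PotentialBound r E k
    PotentialBound-0 r E k none =
      subst (λ b → (2 + r) * (K * b) ≤ n ^ r * potential k + k * (K * b)) (sym none)
        (subst (_≤ n ^ r * potential k + k * (K * 0))
          (sym (trans (cong ((2 + r) *_) (*-zeroʳ K)) (*-zeroʳ (2 + r)))) z≤n)

    module Step (E : List (Edge n)) (r j : ℕ) (#roots≡2+j : #roots (label E) ≡ 2 + j)
                (ih : ∀ u → PotentialBound r (next E u) (#roots (label (next E u)))) where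

      private
        f = label E
        v = joinSmallest E
        k = 2 + j
        x : Fin n → ℕ
        x u = K * #disconnectedRuns (next E u) r

      -- An outcome u in the class of v costs a round; any other u merges two classes.
      cost : Fin n → ℕ
      cost u = potential (suc j) + (weight (suc j) + K) * 𝟙 (f u == f v)

      cost-bound : ∀ u → (3 + r) * x u ≤ n ^ r * cost u + k * x u
      cost-bound u = by-cases (f u == f v) refl
        where
        open ≤-Reasoning
        by-cases : ∀ b → (f u == f v) ≡ b →
          (3 + r) * x u ≤ n ^ r * (potential (suc j) + (weight (suc j) + K) * 𝟙 b) + k * x u
        by-cases true same = begin
          x u + (2 + r) * x u                                 ≡⟨ +-comm (x u) ((2 + r) * x u) ⟩
          (2 + r) * x u + x u                                 ≤⟨ +-mono-≤ ih-same x≤ ⟩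
          n ^ r * potential k + k * x u + n ^ r * K
            ≡⟨ regroup (n ^ r) (potential (suc j)) (weight (suc j)) K (k * x u) ⟩
          n ^ r * (potential (suc j) + (weight (suc j) + K) * 1) + k * x u ∎
          where
          ih-same : (2 + r) * x u ≤ n ^ r * potential k + k * x u
          ih-same = subst (PotentialBound r (next E u)) (trans (#roots-snoc-same E u v same) #roots≡2+j) (ih u)
          x≤ : x u ≤ n ^ r * K
          x≤ = ≤-trans (*-monoʳ-≤ K (#disconnectedRuns≤ (next E u) r)) (≤-reflexive (*-comm K (n ^ r)))
          regroup : ∀ a p w c y → a * (p + w) + y + a * c ≡ a * (p + (w + c) * 1) + y
          regroup = solve-∀
        by-cases false different = begin
          x u + (2 + r) * x u                                 ≡⟨ +-comm (x u) ((2 + r) * x u) ⟩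
          (2 + r) * x u + x u                                 ≤⟨ +-monoˡ-≤ (x u) ih-merge ⟩
          n ^ r * potential (suc j) + suc j * x u + x u
            ≡⟨ regroup (n ^ r) (potential (suc j)) (weight (suc j) + K) j (x u) ⟩
          n ^ r * (potential (suc j) + (weight (suc j) + K) * 0) + k * x u ∎
          where
          ih-merge : (2 + r) * x u ≤ n ^ r * potential (suc j) + suc j * x u
          ih-merge = subst (PotentialBound r (next E u))
            (suc-injective (trans (+-comm 1 _) (trans (#roots-snoc-merge E u v different) #roots≡2+j))) (ih u)
          regroup : ∀ a p c i y → a * p + (1 + i) * y + y ≡ a * (p + c * 0) + (2 + i) * y
          regroup = solve-∀

      private
        a = classSize f (f v)

      sum-cost : sum cost ≤ n * potential k
      sum-cost = begin
        sum cost
          ≡⟨ ∑-distrib-+ (λ _ → potential (suc j)) (λ u → (weight (suc j) + K) * 𝟙 (f u == f v)) ⟩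
        sum {n} (λ _ → potential (suc j)) + sum (λ u → (weight (suc j) + K) * 𝟙 (f u == f v))
          ≡⟨ cong₂ _+_ (sum-const n (potential (suc j)))
                       (sym (*-distribˡ-sum (weight (suc j) + K) (λ u → 𝟙 (f u == f v)))) ⟩
        n * potential (suc j) + (weight (suc j) + K) * a
          ≤⟨ +-monoʳ-≤ (n * potential (suc j)) (weight-absorbs j a k*a≤n) ⟩
        n * potential (suc j) + n * weight (suc j)
          ≡⟨ *-distribˡ-+ n (potential (suc j)) (weight (suc j)) ⟨
        n * potential k ∎
        where
        open ≤-Reasoning
        k*a≤n : k * a ≤ n
        k*a≤n = subst (λ c → c * a ≤ n) #roots≡2+j
                  (#roots*minClassSize≤n f v (label-idempotent E) (joinSmallest-minimal E))

      potentialBound : PotentialBound (suc r) E k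
      potentialBound = begin
        (3 + r) * (K * sum b)                  ≡⟨ cong ((3 + r) *_) (*-distribˡ-sum K b) ⟩
        (3 + r) * sum x                        ≤⟨ sum-linear-≤ (3 + r) k x (λ u → n ^ r * cost u) cost-bound ⟩
        sum (λ u → n ^ r * cost u) + k * sum x
          ≡⟨ cong₂ _+_ (*-distribˡ-sum (n ^ r) cost) (cong (k *_) (*-distribˡ-sum K b)) ⟨
        n ^ r * sum cost + k * (K * sum b)     ≤⟨ +-monoˡ-≤ (k * (K * sum b)) (*-monoʳ-≤ (n ^ r) sum-cost) ⟩
        n ^ r * (n * potential k) + k * (K * sum b)
          ≡⟨ cong (_+ k * (K * sum b))
               (trans (cong (_* potential k) (*-comm n (n ^ r))) (*-assoc (n ^ r) n (potential k))) ⟨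
        n * n ^ r * potential k + k * (K * sum b) ∎
        where
        open ≤-Reasoning
        b : Fin n → ℕ
        b u = #disconnectedRuns (next E u) r

    potential-bound : ∀ r E → PotentialBound r E (#roots (label E))
    potential-bound zero E with isConnected E in conn
    ... | true  rewrite *-zeroʳ K = z≤n
    ... | false = ≤-trans (*-monoˡ-≤ (K * 1) (isConnected≡false⇒2≤#roots E conn)) (m≤n+m _ _)
    potential-bound (suc r) E = by-#roots (#roots (label E)) refl
      where
      connected : ∀ k → #roots (label E) ≡ k → k ≤ 1 → PotentialBound (suc r) E k
      connected k #roots≡k k≤1 = PotentialBound-0 (suc r) E k
        (isConnected⇒#disconnectedRuns≡0 E (suc r) (dec-true (_ ≤? 1) (subst (_≤ 1) (sym #roots≡k) k≤1)))
      by-#roots : ∀ k → #roots (label E) ≡ k → PotentialBound (suc r) E k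
      by-#roots zero          #roots≡k  = connected 0 #roots≡k z≤n
      by-#roots (suc zero)    #roots≡k  = connected 1 #roots≡k ≤-refl
      by-#roots (suc (suc j)) #roots≡k  = Step.potentialBound E r j #roots≡k (λ u → potential-bound r (next E u))

  -- With K = 2ps the potential of the n initial singleton classes is at most K² + n ≤ 2n.
  #disconnectedRuns-≤ : ∀ p s d .{{_ : NonZero p}} → (2 * p * s) * (2 * p * s) ≤ n → n ≤ p * suc d →
    #disconnectedRuns [] (n + d) * s ≤ n ^ (n + d)
  #disconnectedRuns-≤ p s d K²≤n n≤p[1+d] = *-cancelˡ-≤ (2 * p) {{2p-nonZero}} (*-cancelˡ-≤ (2 + d) (begin
      (2 + d) * (2 * p * (b * s))      ≡⟨ rearrange (2 + d) (2 * p) b s ⟩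
      (2 + d) * (K * b)                ≤⟨ cancel-n-classes ⟩
      T * potential n                  ≤⟨ *-monoʳ-≤ T potential-n≤2n ⟩
      T * (2 * n)                      ≤⟨ *-monoʳ-≤ T (*-monoʳ-≤ 2 (≤-trans n≤p[1+d] (*-monoʳ-≤ p (n≤1+n (suc d))))) ⟩
      T * (2 * (p * (2 + d)))          ≡⟨ regroup T p (2 + d) ⟩
      (2 + d) * (2 * p * T)            ∎))
    where
    open ≤-Reasoning
    open Potential (2 * p * s)
    K = 2 * p * s
    t = n + d
    b = #disconnectedRuns [] t
    T = n ^ t
    2p-nonZero : NonZero (2 * p)
    2p-nonZero = m*n≢0 2 p
    rearrange : ∀ a q b s → a * (q * (b * s)) ≡ a * (q * s * b)
    rearrange = solve-∀
    regroup : ∀ T p a → T * (2 * (p * a)) ≡ a * (2 * p * T)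
    regroup = solve-∀
    split : ∀ n d y → (2 + (n + d)) * y ≡ n * y + (2 + d) * y
    split = solve-∀
    cancel-n-classes : (2 + d) * (K * b) ≤ T * potential n
    cancel-n-classes = +-cancelˡ-≤ (n * (K * b)) _ _ (begin
      n * (K * b) + (2 + d) * (K * b) ≡⟨ split n d (K * b) ⟨
      (2 + t) * (K * b)               ≤⟨ subst (PotentialBound t []) #roots-id (potential-bound t []) ⟩
      T * potential n + n * (K * b)   ≡⟨ +-comm (T * potential n) (n * (K * b)) ⟩
      n * (K * b) + T * potential n   ∎)
    potential-n≤2n : potential n ≤ 2 * n
    potential-n≤2n = begin
      potential n ≤⟨ potential-≤ n ⟩
      K * K + n   ≤⟨ +-monoˡ-≤ n K²≤n ⟩
      n + n       ≡⟨ cong (n +_) (+-identityʳ n) ⟨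
      2 * n       ∎

module RationalBounds where

  open import Data.Integer as ℤ using (+_; +[1+_])
  import Data.Integer.Properties as ℤ
  open import Data.Nat as ℕ using (ℕ; suc)
  import Data.Nat.Properties as ℕ
  open import Data.Nat.Coprimality using (1-coprimeTo) renaming (sym to coprime-sym)
  open import Data.Product using (Σ; _×_; _,_)
  open import Data.Rational
  open import Data.Rational.Properties
  open import Data.Rational.Solver using (module +-*-Solver)
  import Data.Rational.Unnormalised as ℚᵘ
  import Data.Rational.Unnormalised.Properties as ℚᵘ
  open import Relation.Binary.PropositionalEquality
  open import Relation.Nullary using (yes; no)

  private
    ℕ→mkℚ : ℕ → ℚ
    ℕ→mkℚ k = mkℚ (+ k) 0 (coprime-sym (1-coprimeTo k))

    ℕ→ℚ≡mkℚ : ∀ k → ℕ→ℚ k ≡ ℕ→mkℚ k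
    ℕ→ℚ≡mkℚ k = ↥p/↧p≡p (ℕ→mkℚ k)

  ℕ→ℚ-homo-+ : ∀ a b → ℕ→ℚ (a ℕ.+ b) ≡ ℕ→ℚ a + ℕ→ℚ b
  ℕ→ℚ-homo-+ a b rewrite ℕ→ℚ≡mkℚ (a ℕ.+ b) | ℕ→ℚ≡mkℚ a | ℕ→ℚ≡mkℚ b =
    toℚᵘ-injective (ℚᵘ.≃-trans (ℚᵘ.*≡* numerators) (ℚᵘ.≃-sym (toℚᵘ-homo-+ (ℕ→mkℚ a) (ℕ→mkℚ b))))
    where
    numerators : + (a ℕ.+ b) ℤ.* + 1 ≡ (+ a ℤ.* + 1 ℤ.+ + b ℤ.* + 1) ℤ.* + 1
    numerators rewrite ℤ.*-identityʳ (+ a) | ℤ.*-identityʳ (+ b) = refl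

  ℕ→ℚ-homo-* : ∀ a b → ℕ→ℚ (a ℕ.* b) ≡ ℕ→ℚ a * ℕ→ℚ b
  ℕ→ℚ-homo-* a b rewrite ℕ→ℚ≡mkℚ (a ℕ.* b) | ℕ→ℚ≡mkℚ a | ℕ→ℚ≡mkℚ b =
    toℚᵘ-injective (ℚᵘ.≃-trans (ℚᵘ.*≡* numerators) (ℚᵘ.≃-sym (toℚᵘ-homo-* (ℕ→mkℚ a) (ℕ→mkℚ b))))
    where
    numerators : + (a ℕ.* b) ℤ.* + 1 ≡ (+ a ℤ.* + b) ℤ.* + 1
    numerators rewrite sym (ℤ.pos-* a b) = refl

  ℕ→ℚ-mono-≤ : ∀ {a b} → a ℕ.≤ b → ℕ→ℚ a ≤ ℕ→ℚ b
  ℕ→ℚ-mono-≤ {a} {b} a≤b rewrite ℕ→ℚ≡mkℚ a | ℕ→ℚ≡mkℚ b = *≤* cross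
    where
    cross : + a ℤ.* + 1 ℤ.≤ + b ℤ.* + 1
    cross rewrite ℤ.*-identityʳ (+ a) | ℤ.*-identityʳ (+ b) = ℤ.+≤+ a≤b

  ℕ→ℚ-cancel-< : ∀ {a b} → ℕ→ℚ a < ℕ→ℚ b → a ℕ.< b
  ℕ→ℚ-cancel-< {a} {b} a<b rewrite ℕ→ℚ≡mkℚ a | ℕ→ℚ≡mkℚ b = cross (drop-*<* a<b)
    where
    cross : + a ℤ.* + 1 ℤ.< + b ℤ.* + 1 → a ℕ.< b
    cross rewrite ℤ.*-identityʳ (+ a) | ℤ.*-identityʳ (+ b) = ℤ.drop‿+<+

  ℕ→ℚ-nonNeg : ∀ k → NonNegative (ℕ→ℚ k)
  ℕ→ℚ-nonNeg k = nonNegative (ℕ→ℚ-mono-≤ {0} {k} ℕ.z≤n)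

  0<1 : 0ℚ < 1ℚ
  0<1 = *<* (ℤ.+<+ (ℕ.s≤s ℕ.z≤n))

  ℕ→ℚ-pos : ∀ {k} → 1 ℕ.≤ k → 0ℚ < ℕ→ℚ k
  ℕ→ℚ-pos 1≤k = <-≤-trans 0<1 (ℕ→ℚ-mono-≤ 1≤k)

  -- ε = (1 + k) / (1 + d) satisfies ε · (1 + d) ≥ 1.
  archimedean : ∀ ε → 0ℚ < ε → Σ ℕ λ p → 1ℚ ≤ ε * ℕ→ℚ (suc p)
  archimedean (mkℚ (+ 0)      _ _) 0<ε with ℤ.+<+ () ← drop-*<* 0<ε
  archimedean (mkℚ ℤ.-[1+ _ ] _ _) 0<ε with () ← drop-*<* 0<ε
  archimedean ε@(mkℚ +[1+ k ] d _) _ = d , goal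
    where
    goal : 1ℚ ≤ ε * ℕ→ℚ (suc d)
    goal rewrite ℕ→ℚ≡mkℚ (suc d) =
      toℚᵘ-cancel-≤ (ℚᵘ.≤-respʳ-≃ (ℚᵘ.≃-sym (toℚᵘ-homo-* ε (ℕ→mkℚ (suc d)))) (ℚᵘ.*≤* cross))
      where
      cross : + 1 ℤ.* + suc (d ℕ.* 1) ℤ.≤ (+[1+ k ] ℤ.* + suc d) ℤ.* + 1
      cross rewrite ℤ.*-identityˡ (+ suc (d ℕ.* 1)) | ℤ.*-identityʳ (+[1+ k ] ℤ.* + suc d)
                  | sym (ℤ.pos-* (suc k) (suc d)) | ℕ.*-identityʳ d = ℤ.+≤+ (ℕ.m≤m+n (suc d) (k ℕ.* suc d))

  0<1-q : ∀ {q} → q < 1ℚ → 0ℚ < 1ℚ - q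
  0<1-q {q} q<1 = subst (_< 1ℚ - q) (+-inverseʳ q) (+-monoˡ-< (- q) q<1)

  pos*ℕ→ℚ-pos : ∀ {q k} → 0ℚ < q → 1 ℕ.≤ k → 0ℚ < q * ℕ→ℚ k
  pos*ℕ→ℚ-pos {q} {k} 0<q 1≤k =
    positive⁻¹ _ {{pos*pos⇒pos q {{positive 0<q}} (ℕ→ℚ k) {{positive (ℕ→ℚ-pos 1≤k)}}}}

  between : ∀ {q₀} → q₀ < 1ℚ → Σ ℚ λ q → q₀ ≤ q × q < 1ℚ × 0ℚ < q
  between {q₀} q₀<1 with q₀ ≤? 0ℚ | <-dense 0<1 | <-dense q₀<1
  ... | yes q₀≤0 | q , 0<q , q<1 | _             = q , ≤-trans q₀≤0 (<⇒≤ 0<q) , q<1 , 0<q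
  ... | no  q₀≰0 | _             | q , q₀<q , q<1 = q , <⇒≤ q₀<q , q<1 , <-trans (≰⇒> q₀≰0) q₀<q

  q*x+[1-q]*x≡x : ∀ q x → q * x + (1ℚ - q) * x ≡ x
  q*x+[1-q]*x≡x = solve 2 (λ q x → q :* x :+ (con 1ℚ :- q) :* x := x) refl
    where open +-*-Solver

  ℕ→ℚ-≤-scaled : ∀ {c} p x y → 0ℚ ≤ c → 1ℚ ≤ c * ℕ→ℚ p → p ℕ.* x ℕ.≤ y → ℕ→ℚ x ≤ c * ℕ→ℚ y
  ℕ→ℚ-≤-scaled {c} p x y 0≤c 1≤cp px≤y = begin
    ℕ→ℚ x                   ≡⟨ *-identityˡ (ℕ→ℚ x) ⟨
    1ℚ * ℕ→ℚ x              ≤⟨ *-monoʳ-≤-nonNeg (ℕ→ℚ x) {{ℕ→ℚ-nonNeg x}} 1≤cp ⟩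
    c * ℕ→ℚ p * ℕ→ℚ x       ≡⟨ *-assoc c (ℕ→ℚ p) (ℕ→ℚ x) ⟩
    c * (ℕ→ℚ p * ℕ→ℚ x)     ≡⟨ cong (c *_) (ℕ→ℚ-homo-* p x) ⟨
    c * ℕ→ℚ (p ℕ.* x)       ≤⟨ *-monoˡ-≤-nonNeg c {{nonNegative 0≤c}} (ℕ→ℚ-mono-≤ px≤y) ⟩
    c * ℕ→ℚ y               ∎
    where open ≤-Reasoning

  n+d≤[1+ε]n : ∀ {ε} p n d → 0ℚ < ε → 1ℚ ≤ ε * ℕ→ℚ p → p ℕ.* d ℕ.≤ n → ℕ→ℚ (n ℕ.+ d) ≤ (1ℚ + ε) * ℕ→ℚ n
  n+d≤[1+ε]n {ε} p n d 0<ε 1≤εp pd≤n = begin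
    ℕ→ℚ (n ℕ.+ d)           ≡⟨ ℕ→ℚ-homo-+ n d ⟩
    ℕ→ℚ n + ℕ→ℚ d           ≤⟨ +-monoʳ-≤ (ℕ→ℚ n) (ℕ→ℚ-≤-scaled p d n (<⇒≤ 0<ε) 1≤εp pd≤n) ⟩
    ℕ→ℚ n + ε * ℕ→ℚ n       ≡⟨ cong (_+ ε * ℕ→ℚ n) (*-identityˡ (ℕ→ℚ n)) ⟨
    1ℚ * ℕ→ℚ n + ε * ℕ→ℚ n  ≡⟨ *-distribʳ-+ (ℕ→ℚ n) 1ℚ ε ⟨
    (1ℚ + ε) * ℕ→ℚ n        ∎
    where open ≤-Reasoning

  q[g+b]≤g : ∀ {q} s g b → q < 1ℚ → 1ℚ ≤ (1ℚ - q) * ℕ→ℚ s → b ℕ.* s ℕ.≤ g ℕ.+ b → q * ℕ→ℚ (g ℕ.+ b) ≤ ℕ→ℚ g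
  q[g+b]≤g {q} s g b q<1 1≤[1-q]s bs≤g+b = begin
    q * T                              ≡⟨ +-cancel (q * T) B ⟩
    q * T + B - B                      ≤⟨ +-monoˡ-≤ (- B) (+-monoʳ-≤ (q * T) B≤[1-q]T) ⟩
    q * T + (1ℚ - q) * T - B           ≡⟨ cong (_- B) (q*x+[1-q]*x≡x q T) ⟩
    T - B                              ≡⟨ cong (_- B) (ℕ→ℚ-homo-+ g b) ⟩
    ℕ→ℚ g + B - B                      ≡⟨ +-cancel (ℕ→ℚ g) B ⟨
    ℕ→ℚ g                              ∎
    where
    open ≤-Reasoning
    open +-*-Solver
    T = ℕ→ℚ (g ℕ.+ b)
    B = ℕ→ℚ b
    +-cancel : ∀ x y → x ≡ x + y - y
    +-cancel = solve 2 (λ x y → x := x :+ y :- y) refl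
    B≤[1-q]T : B ≤ (1ℚ - q) * T
    B≤[1-q]T = ℕ→ℚ-≤-scaled s b (g ℕ.+ b) (<⇒≤ (0<1-q q<1)) 1≤[1-q]s (subst (ℕ._≤ g ℕ.+ b) (ℕ.*-comm b s) bs≤g+b)

  t<[1-ε]n⇒1+t<n : ∀ {ε} p n t → 0ℚ < ε → 1ℚ ≤ ε * ℕ→ℚ p → p ℕ.≤ n → ℕ→ℚ t < (1ℚ - ε) * ℕ→ℚ n → suc t ℕ.< n
  t<[1-ε]n⇒1+t<n {ε} p n t 0<ε 1≤εp p≤n t<[1-ε]n = ℕ→ℚ-cancel-< (begin-strict
    ℕ→ℚ (1 ℕ.+ t)               ≡⟨ ℕ→ℚ-homo-+ 1 t ⟩
    1ℚ + ℕ→ℚ t                  <⟨ +-mono-≤-< 1≤εn t<[1-ε]n ⟩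
    ε * N + (1ℚ - ε) * N        ≡⟨ q*x+[1-q]*x≡x ε N ⟩
    N                           ∎)
    where
    open ≤-Reasoning
    N = ℕ→ℚ n
    1≤εn : 1ℚ ≤ ε * N
    1≤εn = ≤-trans 1≤εp (*-monoˡ-≤-nonNeg ε {{nonNegative (<⇒≤ 0<ε)}} (ℕ→ℚ-mono-≤ p≤n))

module Thresholds where

  open import Data.List using ([]; length)
  open import Data.List.Relation.Unary.AllPairs using ([])
  open import Data.Nat as ℕ using (suc; _^_)
  import Data.Nat.Properties as ℕ
  open import Data.Nat.DivMod using (_/_; _%_; m≡m%n+[m/n]*n; m%n<n; m/n*n≤m)
  open import Data.Product using (_,_)
  open import Data.Rational using (ℚ; 0ℚ; 1ℚ; _+_; _-_; _*_; _≤_; _<_)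
  open import Relation.Binary.PropositionalEquality
  open import Relation.Nullary using (contradiction)

  open RationalBounds

  τ≤[1+ε]n : ∀ {ε q} → 0ℚ < ε → q < 1ℚ → Σ ℕ λ N → ∀ n → n ≥ N → TauAtMost n q ((1ℚ + ε) * ℕ→ℚ n)
  τ≤[1+ε]n {ε} {q} 0<ε q<1 with archimedean ε 0<ε | archimedean (1ℚ - q) (0<1-q q<1)
  ... | p-1 , 1≤εp | s-1 , 1≤[1-q]s = K ℕ.* K , at-most
    where
    p = suc p-1
    s = suc s-1
    K = 2 ℕ.* p ℕ.* s
    at-most : ∀ n → n ≥ K ℕ.* K → TauAtMost n q ((1ℚ + ε) * ℕ→ℚ n)
    at-most (suc m) K²≤n =
      joinSmallest , t , n+d≤[1+ε]n p n d 0<ε 1≤εp pd≤n ,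
      connectedRuns [] t , connectedRuns-unique [] t , connectedRuns-connected [] t , enough
      where
      open JoinSmallest m
      d = n / p
      t = n ℕ.+ d
      pd≤n : p ℕ.* d ℕ.≤ n
      pd≤n = ℕ.≤-trans (ℕ.≤-reflexive (ℕ.*-comm p d)) (m/n*n≤m n p)
      n≤p[1+d] : n ℕ.≤ p ℕ.* suc d
      n≤p[1+d] = begin
        n                  ≡⟨ m≡m%n+[m/n]*n n p ⟩
        n % p ℕ.+ d ℕ.* p  ≤⟨ ℕ.+-monoˡ-≤ (d ℕ.* p) (ℕ.<⇒≤ (m%n<n n p)) ⟩
        suc d ℕ.* p        ≡⟨ ℕ.*-comm (suc d) p ⟩
        p ℕ.* suc d        ∎
        where open ℕ.≤-Reasoning
      good = length (connectedRuns [] t)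
      bad  = #disconnectedRuns [] t
      enough : q * ℕ→ℚ (n ^ t) ≤ ℕ→ℚ good
      enough = subst (λ total → q * ℕ→ℚ total ≤ ℕ→ℚ good) (length-connectedRuns+#disconnectedRuns [] t)
        (q[g+b]≤g s good bad q<1 1≤[1-q]s
          (subst (bad ℕ.* s ℕ.≤_) (sym (length-connectedRuns+#disconnectedRuns [] t))
            (#disconnectedRuns-≤ p s d K²≤n n≤p[1+d])))

  τ≥[1-ε]n : ∀ {ε q} → 0ℚ < ε → 0ℚ < q → ∀ N → Σ ℕ λ n → n ≥ N × TauAtLeast n q ((1ℚ - ε) * ℕ→ℚ n)
  τ≥[1-ε]n {ε} {q} 0<ε 0<q N with archimedean ε 0<ε
  ... | p-1 , 1≤εp = n , ℕ.m≤n+m N (suc p-1) , at-least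
    where
    n = suc p-1 ℕ.+ N
    at-least : TauAtLeast n q ((1ℚ - ε) * ℕ→ℚ n)
    at-least S t t<[1-ε]n =
      [] , [] , (λ us connected → contradiction (Outcomes.Connected⇒n≤1+t n S us connected) (ℕ.<⇒≱ 1+t<n)) ,
      pos*ℕ→ℚ-pos 0<q (ℕ.m^n>0 n t)
      where
      1+t<n : suc t ℕ.< n
      1+t<n = t<[1-ε]n⇒1+t<n (suc p-1) n t 0<ε 1≤εp (ℕ.m≤m+n (suc p-1) N) t<[1-ε]n

open Thresholds
open import Data.Rational using (ℚ; 0ℚ; 1ℚ; _+_; _-_; _*_; _≤_; _<_)
open RationalBounds using (0<1; between)

lemma4p2 : ((ε : ℚ) → 0ℚ < ε → Σ ℚ λ q₀ → q₀ < 1ℚ ×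
    ((q : ℚ) → q₀ ≤ q → q < 1ℚ →
    Σ ℕ λ N → (n : ℕ) → n ≥ N → TauAtMost n q ((1ℚ + ε) * ℕ→ℚ n)))
    ×
    ((ε : ℚ) → 0ℚ < ε → (q₀ : ℚ) → q₀ < 1ℚ →
    Σ ℚ λ q → q₀ ≤ q × q < 1ℚ ×
    ((N : ℕ) → Σ ℕ λ n → n ≥ N × TauAtLeast n q ((1ℚ - ε) * ℕ→ℚ n)))
lemma4p2 = (λ ε 0<ε → 0ℚ , 0<1 , λ q _ q<1 → τ≤[1+ε]n 0<ε q<1)
         , (λ ε 0<ε q₀ q₀<1 → let q , q₀≤q , q<1 , 0<q = between q₀<1 in q , q₀≤q , q<1 , τ≥[1-ε]n 0<ε 0<q)
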